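{- For every integer $n\ge 1$ and every permutation $\pi\in\mathcal{S}_n$, \[\mathrm{SP}(n,\pi)=2^{n(n-1)-\mathrm{inv}(\pi)},\qquad \mathrm{SP}(n)=\prod_{i=0}^{n-1}\left(2^n-2^i\right).\]
   Context: Let $[n]=\{1,\dots,n\}$ and let $\mathcal{S}_n$ be the set of permutations of $[n]$ written in one-line notation $\pi=\pi_1\cdots\pi_n$; write $\pi_i^{ -1}$ for the position $j$ with $\pi_j=i$. A tuple $(C_1,\dots,C_n)$ of non-empty subsets of $[n]$ is a subset parking function with outcome $\pi\in\mathcal{S}_n$ if for every $1\le i\le n$, the position $j=\pi_i^{ -1}$ is the smallest element of $C_i\setminus\{\pi_{i'}^{ -1}: i'<i\}$ (car $i$ parks in the leftmost still-empty spot belonging to $C_i$). $\mathrm{SP}(n,\pi)$ is the number of subset parking functions with outcome $\pi$, and $\mathrm{SP}(n)=\sum_{\pi\in\mathcal{S}_n}\mathrm{SP}(n,\pi)$. The inversion number $\mathrm{inv}(\pi)$ is the number of pairs $(i,j)$ with $i<j$ and $\pi_j<\pi_i$. -}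

module Defs where

open import Data.Nat using (ℕ; zero; suc; _+_; _*_; _∸_; _^_; _≤_)
open import Data.Nat.ListAction using (sum; product)
open import Data.Bool using (Bool; true; false)
open import Data.Fin using (Fin; toℕ) renaming (_<_ to _<ᶠ_)
open import Data.Fin.Properties using (all?; any?; _≟_; _<?_)
open import Data.Fin.Subset using (Subset; _∈_; Nonempty)
open import Data.Fin.Subset.Properties using (_∈?_; nonempty?)
open import Data.Vec using (Vec; lookup; []; _∷_)
open import Data.List using (List; []; _∷_; length; filter; map; concatMap; allFin; upTo)
open import Data.Product using (_×_; ∃; ∃-syntax; _,_)
open import Relation.Binary.PropositionalEquality using (_≡_)
open import Relation.Nullary using (Dec; ¬_; ¬?)
open import Relation.Nullary.Decidable.Core using (_×-dec_; _→-dec_)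

allVecs : ∀ {A : Set} → List A → (n : ℕ) → List (Vec A n)
allVecs xs zero    = [] ∷ []
allVecs xs (suc n) = concatMap (λ x → map (x ∷_) (allVecs xs n)) xs

-- Positions / values / cars are indexed by Fin n (0-based version of [n]).
-- A word π (one-line notation, π_j = lookup π j) is a permutation iff it is injective
-- (for maps Fin n → Fin n this is the same as bijective).
IsPerm : ∀ {n} → Vec (Fin n) n → Set
IsPerm π = ∀ j k → lookup π j ≡ lookup π k → j ≡ k

isPerm? : ∀ {n} (π : Vec (Fin n) n) → Dec (IsPerm π)
isPerm? π = all? λ j → all? λ k → (lookup π j ≟ lookup π k) →-dec (j ≟ k)

Perms : (n : ℕ) → List (Vec (Fin n) n)
Perms n = filter isPerm? (allVecs (allFin n) n)

-- The set {π_{i'}^{-1} : i' < i} of spots taken by earlier cars; k belongs to it iff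
-- the car π_k at spot k is some i' < i  (π_{i'}^{-1} = k  means  π_k = i').
Earlier : ∀ {n} → Vec (Fin n) n → Fin n → Fin n → Set
Earlier π i k = ∃[ i' ] (i' <ᶠ i × lookup π k ≡ i')

earlier? : ∀ {n} (π : Vec (Fin n) n) i k → Dec (Earlier π i k)
earlier? π i k = any? λ i' → (i' <? i) ×-dec (lookup π k ≟ i')

IsMinDiff : ∀ {n} → Subset n → (Fin n → Set) → Fin n → Set
IsMinDiff C E j = (j ∈ C × ¬ E j) × (∀ k → k ∈ C → ¬ E k → toℕ j ≤ toℕ k)

-- (C_1,…,C_n) is a subset parking function with outcome π:
-- every C_i is non-empty, and for every car i, the position j = π_i^{-1}
-- (i.e. the j with π_j = i) is the smallest element of C_i \ {π_{i'}^{-1} : i' < i}.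
IsSPF : ∀ {n} → Vec (Fin n) n → Vec (Subset n) n → Set
IsSPF π C =
  (∀ i → Nonempty (lookup C i)) ×
  (∀ i j → lookup π j ≡ i → IsMinDiff (lookup C i) (Earlier π i) j)

isSPF? : ∀ {n} (π : Vec (Fin n) n) (C : Vec (Subset n) n) → Dec (IsSPF π C)
isSPF? π C =
  (all? λ i → nonempty? (lookup C i)) ×-dec
  (all? λ i → all? λ j → (lookup π j ≟ i) →-dec
     (((j ∈? lookup C i) ×-dec ¬? (earlier? π i j)) ×-dec
      (all? λ k → (k ∈? lookup C i) →-dec (¬? (earlier? π i k) →-dec (toℕ j Data.Nat.≤? toℕ k)))))
  where import Data.Nat

allSubsets : (n : ℕ) → List (Subset n)
allSubsets n = allVecs (true ∷ false ∷ []) n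

SP-π : (n : ℕ) → Vec (Fin n) n → ℕ
SP-π n π = length (filter (isSPF? π) (allVecs (allSubsets n) n))

SP : ℕ → ℕ
SP n = sum (map (SP-π n) (Perms n))

inv : ∀ {n} → Vec (Fin n) n → ℕ
inv {n} π = length (filter (λ p → (proj₁ p <? proj₂ p) ×-dec (lookup π (proj₂ p) <? lookup π (proj₁ p)))
                           (concatMap (λ i → map (i ,_) (allFin n)) (allFin n)))
  where open Data.Product using (proj₁; proj₂)

module Submission where

-- Let σ = π⁻¹, so car i parks at spot σ i.  A tuple
-- (C_i) has outcome π iff cell by cell: σ i ∈ C_i, and no spot k < σ i that is still
-- empty when car i arrives ("blocked") lies in C_i; all other cells are free.  Hence
-- SP(n, π) = 2^(number of free cells), and reindexing cars by their spots turns the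
-- blocked cells into the inversions of π, so there are n(n−1) − inv π free cells.
--
-- Weight a word v ∈ [n]^n by placing
-- its letters from left to right: a letter with r still-free values below it gets
-- 2^(n−1−r), an already used letter gets 0.  Summing over the first letter is a
-- geometric sum 2^n − 2^ℓ (ℓ = number of used values), so the total weight of all
-- words is ∏_i (2^n − 2^i).  Non-permutations weigh 0, and a permutation weighs
-- 2^(n(n−1) − inv π) = SP(n, π) by counting the free values below each letter.

open import Defs
open import Data.Nat using (ℕ; _*_; _∸_; _^_; _≤_)
open import Data.Nat.ListAction using (product)
open import Data.List using (map; upTo)
open import Data.Fin using (Fin)
open import Data.Vec using (Vec)
open import Data.Product using (_×_)
open import Relation.Binary.PropositionalEquality using (_≡_)

open import Data.Nat using (zero; suc; _+_; _<_; z≤n; s≤s)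
open import Data.Nat.Properties
  using (+-identityʳ; +-assoc; +-comm; +-suc; *-identityʳ; *-zeroʳ; *-distribˡ-∸;
         m+n∸m≡n; m+n∸n≡m; m+[n∸m]≡n; +-mono-≤; ^-distribˡ-+-*; ∸-+-assoc)
import Data.Nat.Properties as ℕ
open import Data.Nat.ListAction using (sum)
open import Data.Bool using (Bool; true; false; if_then_else_; T)
open import Data.Fin using (zero; suc; toℕ; punchOut) renaming (_<_ to _<ᶠ_)
open import Data.Fin.Properties using (_≟_; _<?_; all?; any?; ¬∀⟶∃¬; pigeonhole; punchOut-injective)
  renaming (<-irrefl to <ᶠ-irrefl; <-asym to <ᶠ-asym; <-cmp to <ᶠ-cmp)
open import Data.Fin.Permutation using (permutation)
open import Data.List using (List; []; _∷_; _++_; length; filter; concatMap; allFin; tabulate; applyUpTo)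
open import Data.List.Properties using (map-cong; map-∘; map-++; map-tabulate; map-upTo)
open import Data.Nat.ListAction.Properties using (sum-++)
open import Data.Vec using (lookup) renaming (_∷_ to _∷ᵛ_)
open import Data.Product using (_,_; proj₁; proj₂; ∃-syntax; ∃₂)
open import Function using (_∘_)
open import Relation.Binary.PropositionalEquality using (_≢_; refl; sym; trans; cong; cong₂; subst; module ≡-Reasoning)
open import Relation.Binary using (tri<; tri≈; tri>)
open import Relation.Nullary using (Dec; yes; no; does; ¬_; contradiction)
open import Relation.Nullary.Decidable.Core using (_×-dec_; _→-dec_; ¬?; T?)
open import Relation.Nullary.Decidable using (dec-true; dec-false)
open import Data.Bool.Properties using () renaming (_≟_ to _≟ᵇ_)
open import Data.Fin.Subset using (Subset; _∈_)
open import Data.Vec.Properties using ([]=⇒lookup; lookup⇒[]=)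
open import Data.Empty using (⊥-elim)
open import Algebra.Properties.Semiring.Sum ℕ.+-*-semiring
  using (∑-distrib-+; ∑-comm; sum-permute; sum-cong-≗; sum-replicate-zero)
  renaming (sum to ∑)
open import Algebra.Properties.CommutativeMonoid.Sum ℕ.*-1-commutativeMonoid
  using () renaming (sum to ∏; sum-cong-≗ to ∏-cong; sum-replicate-zero to ∏-ones)

𝟙 : {P : Set} → Dec P → ℕ
𝟙 d = if does d then 1 else 0

module _ {P : Set} where

  𝟙-yes : (d : Dec P) → P → 𝟙 d ≡ 1
  𝟙-yes (yes _) _ = refl
  𝟙-yes (no ¬x) x = contradiction x ¬x

  𝟙-no : (d : Dec P) → ¬ P → 𝟙 d ≡ 0
  𝟙-no (yes x) ¬x = contradiction x ¬x
  𝟙-no (no _) _ = refl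

  𝟙≤1 : (d : Dec P) → 𝟙 d ≤ 1
  𝟙≤1 (yes _) = s≤s z≤n
  𝟙≤1 (no _) = z≤n

𝟙-⇔ : ∀ {P Q : Set} (d : Dec P) (e : Dec Q) → (P → Q) → (Q → P) → 𝟙 d ≡ 𝟙 e
𝟙-⇔ (yes x) e to from = sym (𝟙-yes e (to x))
𝟙-⇔ (no ¬x) e to from = sym (𝟙-no e (¬x ∘ from))

𝟙-× : ∀ {P Q : Set} (d : Dec P) (e : Dec Q) → 𝟙 (d ×-dec e) ≡ 𝟙 d * 𝟙 e
𝟙-× (yes _) (yes _) = refl
𝟙-× (yes _) (no _) = refl
𝟙-× (no _) _ = refl

∑-zero : ∀ {n} (f : Fin n → ℕ) → (∀ i → f i ≡ 0) → ∑ f ≡ 0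
∑-zero {n} f f≡0 = trans (sum-cong-≗ f≡0) (sum-replicate-zero n)

∑-const : ∀ n (c : ℕ) → ∑ {n} (λ _ → c) ≡ n * c
∑-const zero c = refl
∑-const (suc n) c = cong (c +_) (∑-const n c)

∑-ones : ∀ n → ∑ {n} (λ _ → 1) ≡ n
∑-ones n = trans (∑-const n 1) (*-identityʳ n)

∑-mono : ∀ {n} {f g : Fin n → ℕ} → (∀ i → f i ≤ g i) → ∑ f ≤ ∑ g
∑-mono {zero} f≤g = z≤n
∑-mono {suc n} f≤g = +-mono-≤ (f≤g zero) (∑-mono (f≤g ∘ suc))

∑-δ : ∀ {n} (a : Fin n) → ∑ (λ k → 𝟙 (k ≟ a)) ≡ 1
∑-δ {suc n} zero = cong suc (∑-zero {n} _ (λ k → refl))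
∑-δ {suc n} (suc a) = ∑-δ {n} a

∏-zero : ∀ {n} (f : Fin n → ℕ) (i : Fin n) → f i ≡ 0 → ∏ f ≡ 0
∏-zero f zero fi≡0 = cong (_* ∏ (f ∘ suc)) fi≡0
∏-zero f (suc i) fi≡0 = trans (cong (f zero *_) (∏-zero (f ∘ suc) i fi≡0)) (*-zeroʳ (f zero))

∏-2^ : ∀ {n} (f : Fin n → ℕ) → ∏ (λ i → 2 ^ f i) ≡ 2 ^ ∑ f
∏-2^ {zero} f = refl
∏-2^ {suc n} f = trans (cong (2 ^ f zero *_) (∏-2^ (f ∘ suc))) (sym (^-distribˡ-+-* 2 (f zero) _))

𝟙-all : ∀ {n} {P : Fin n → Set} (P? : ∀ i → Dec (P i)) → 𝟙 (all? P?) ≡ ∏ (λ i → 𝟙 (P? i))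
𝟙-all {n} P? with all? P?
... | yes ∀P = trans (𝟙-yes (all? P?) ∀P) (sym (trans (∏-cong (λ i → 𝟙-yes (P? i) (∀P i))) (∏-ones n)))
... | no ¬∀P with ¬∀⟶∃¬ n _ P? ¬∀P
...   | i , ¬Pi = trans (𝟙-no (all? P?) ¬∀P) (sym (∏-zero _ i (𝟙-no (P? i) ¬Pi)))

∑-complement : ∀ {n} (b c : Fin n → ℕ) → (∀ i → 1 + b i + c i ≡ n) →
  ∑ c ≡ n * (n ∸ 1) ∸ ∑ b
∑-complement {n} b c split = begin
  ∑ c                           ≡⟨ sym (m+n∸m≡n (n + ∑ b) (∑ c)) ⟩
  n + ∑ b + ∑ c ∸ (n + ∑ b)     ≡⟨ cong (_∸ (n + ∑ b)) total ⟩
  n * n ∸ (n + ∑ b)             ≡⟨ sym (∸-+-assoc (n * n) n (∑ b)) ⟩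
  n * n ∸ n ∸ ∑ b               ≡⟨ cong (λ m → n * n ∸ m ∸ ∑ b) (sym (*-identityʳ n)) ⟩
  n * n ∸ n * 1 ∸ ∑ b           ≡⟨ cong (_∸ ∑ b) (sym (*-distribˡ-∸ n n 1)) ⟩
  n * (n ∸ 1) ∸ ∑ b             ∎
  where
  open ≡-Reasoning
  total : n + ∑ b + ∑ c ≡ n * n
  total = begin
    n + ∑ b + ∑ c                   ≡⟨ cong (λ m → m + ∑ b + ∑ c) (sym (∑-ones n)) ⟩
    ∑ {n} (λ _ → 1) + ∑ b + ∑ c     ≡⟨ cong (_+ ∑ c) (sym (∑-distrib-+ (λ _ → 1) b)) ⟩
    ∑ (λ i → 1 + b i) + ∑ c         ≡⟨ sym (∑-distrib-+ (λ i → 1 + b i) c) ⟩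
    ∑ (λ i → 1 + b i + c i)         ≡⟨ sum-cong-≗ split ⟩
    ∑ {n} (λ _ → n)                 ≡⟨ ∑-const n n ⟩
    n * n                           ∎

∑-<-vanishing : ∀ {n} (f : Fin n → ℕ) → (∀ i → f i ≤ 1) → (a : Fin n) → f a ≡ 0 → ∑ f < n
∑-<-vanishing {suc n} f f≤1 zero fa≡0 =
  s≤s (subst (λ z → z + ∑ (f ∘ suc) ≤ n) (sym fa≡0)
             (subst (∑ (f ∘ suc) ≤_) (∑-ones n) (∑-mono (f≤1 ∘ suc))))
∑-<-vanishing {suc n} f f≤1 (suc a) fa≡0 =
  ℕ.+-mono-≤-< (f≤1 zero) (∑-<-vanishing (f ∘ suc) (f≤1 ∘ suc) a fa≡0)

Σ[_]_ : ∀ {A : Set} → List A → (A → ℕ) → ℕ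
Σ[ xs ] f = sum (map f xs)

Σ-cong : ∀ {A : Set} (xs : List A) {f g : A → ℕ} → (∀ x → f x ≡ g x) → Σ[ xs ] f ≡ Σ[ xs ] g
Σ-cong xs f≗g = cong sum (map-cong f≗g xs)

Σ-*ˡ : ∀ {A : Set} (xs : List A) (c : ℕ) (f : A → ℕ) → Σ[ xs ] (λ x → c * f x) ≡ c * Σ[ xs ] f
Σ-*ˡ [] c f = sym (*-zeroʳ c)
Σ-*ˡ (x ∷ xs) c f = trans (cong (c * f x +_) (Σ-*ˡ xs c f)) (sym (ℕ.*-distribˡ-+ c (f x) _))

Σ-*ʳ : ∀ {A : Set} (xs : List A) (c : ℕ) (f : A → ℕ) → Σ[ xs ] (λ x → f x * c) ≡ Σ[ xs ] f * c
Σ-*ʳ xs c f = trans (Σ-cong xs (λ x → ℕ.*-comm (f x) c)) (trans (Σ-*ˡ xs c f) (ℕ.*-comm c _))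

Σ-concatMap : ∀ {A B : Set} (g : A → List B) (xs : List A) (f : B → ℕ) →
  Σ[ concatMap g xs ] f ≡ Σ[ xs ] (λ x → Σ[ g x ] f)
Σ-concatMap g [] f = refl
Σ-concatMap g (x ∷ xs) f = begin
  sum (map f (g x ++ concatMap g xs))   ≡⟨ cong sum (map-++ f (g x) (concatMap g xs)) ⟩
  sum (map f (g x) ++ map f (concatMap g xs)) ≡⟨ sum-++ (map f (g x)) _ ⟩
  Σ[ g x ] f + Σ[ concatMap g xs ] f               ≡⟨ cong (Σ[ g x ] f +_) (Σ-concatMap g xs f) ⟩
  Σ[ g x ] f + Σ[ xs ] (λ x → Σ[ g x ] f)          ∎
  where open ≡-Reasoning

Σ-allFin : ∀ n (f : Fin n → ℕ) → Σ[ allFin n ] f ≡ ∑ f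
Σ-allFin n f = trans (cong sum (map-tabulate (λ i → i) f)) (sum-tabulate f)
  where
  sum-tabulate : ∀ {m} (g : Fin m → ℕ) → sum (tabulate g) ≡ ∑ g
  sum-tabulate {zero} g = refl
  sum-tabulate {suc m} g = cong (g zero +_) (sum-tabulate (g ∘ suc))

Σ-filter : ∀ {A : Set} {P : A → Set} (P? : ∀ x → Dec (P x)) (xs : List A) (f : A → ℕ) →
  Σ[ filter P? xs ] f ≡ Σ[ xs ] (λ x → 𝟙 (P? x) * f x)
Σ-filter P? [] f = refl
Σ-filter P? (x ∷ xs) f with P? x
... | yes _ = cong₂ _+_ (sym (+-identityʳ (f x))) (Σ-filter P? xs f)
... | no _ = Σ-filter P? xs f

length-filter : ∀ {A : Set} {P : A → Set} (P? : ∀ x → Dec (P x)) (xs : List A) →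
  length (filter P? xs) ≡ Σ[ xs ] (λ x → 𝟙 (P? x))
length-filter P? [] = refl
length-filter P? (x ∷ xs) with P? x
... | yes _ = cong suc (length-filter P? xs)
... | no _ = length-filter P? xs

Σ-allVecs-suc : ∀ {A : Set} (xs : List A) n (F : Vec A (suc n) → ℕ) →
  Σ[ allVecs xs (suc n) ] F ≡ Σ[ xs ] (λ x → Σ[ allVecs xs n ] (λ v → F (x ∷ᵛ v)))
Σ-allVecs-suc xs n F =
  trans (Σ-concatMap _ xs F) (Σ-cong xs (λ x → cong sum (sym (map-∘ (allVecs xs n)))))

Σ-allVecs-∏ : ∀ {A : Set} (xs : List A) n (g : Fin n → A → ℕ) →
  Σ[ allVecs xs n ] (λ v → ∏ (λ i → g i (lookup v i))) ≡ ∏ (λ i → Σ[ xs ] (g i))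
Σ-allVecs-∏ xs zero g = refl
Σ-allVecs-∏ xs (suc n) g = begin
  Σ[ allVecs xs (suc n) ] (λ v → ∏ (λ i → g i (lookup v i)))
    ≡⟨ Σ-allVecs-suc xs n _ ⟩
  Σ[ xs ] (λ x → Σ[ allVecs xs n ] (λ v → g zero x * rest v))
    ≡⟨ Σ-cong xs (λ x → Σ-*ˡ (allVecs xs n) (g zero x) rest) ⟩
  Σ[ xs ] (λ x → g zero x * Σ[ allVecs xs n ] rest)
    ≡⟨ Σ-cong xs (λ x → cong (g zero x *_) (Σ-allVecs-∏ xs n (g ∘ suc))) ⟩
  Σ[ xs ] (λ x → g zero x * ∏ (λ i → Σ[ xs ] (g (suc i))))
    ≡⟨ Σ-*ʳ xs _ (g zero) ⟩
  Σ[ xs ] (g zero) * ∏ (λ i → Σ[ xs ] (g (suc i)))   ∎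
  where
  open ≡-Reasoning
  rest : Vec _ n → ℕ
  rest v = ∏ (λ i → g (suc i) (lookup v i))

product-upTo : ∀ n (f : ℕ → ℕ) → product (map f (upTo n)) ≡ ∏ (λ (t : Fin n) → f (toℕ t))
product-upTo n f = trans (cong product (map-upTo f n)) (product-applyUpTo n f)
  where
  product-applyUpTo : ∀ m (g : ℕ → ℕ) → product (applyUpTo g m) ≡ ∏ (λ (t : Fin m) → g (toℕ t))
  product-applyUpTo zero g = refl
  product-applyUpTo (suc m) g = cong (g 0 *_) (product-applyUpTo m (g ∘ suc))

-- An injective map Fin n → Fin n is surjective: a missed value would let the
-- map be squeezed into Fin (n − 1), contradicting the pigeonhole principle.
injective⇒surjective : ∀ {n} (f : Fin n → Fin n) → (∀ j k → f j ≡ f k → j ≡ k) →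
  ∀ y → ∃[ j ] f j ≡ y
injective⇒surjective {suc m} f f-inj y with any? (λ j → f j ≟ y)
... | yes hit = hit
... | no miss = contradiction (pigeonhole (ℕ.n<1+n m) squeezed) no-collision
  where
  y≢f : ∀ j → y ≢ f j
  y≢f j y≡fj = miss (j , sym y≡fj)
  squeezed : Fin (suc m) → Fin m
  squeezed j = punchOut (y≢f j)
  no-collision : ¬ ∃₂ λ i j → i <ᶠ j × squeezed i ≡ squeezed j
  no-collision (i , j , i<j , same) =
    <ᶠ-irrefl (f-inj i j (punchOut-injective (y≢f i) (y≢f j) same)) i<j

module Inverse {n} (π : Vec (Fin n) n) (π-inj : IsPerm π) where

  -- π as a function: p j is the car parked at spot j.
  p : Fin n → Fin n
  p = lookup π

  -- σ y is the spot of car y.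
  σ : Fin n → Fin n
  σ y = proj₁ (injective⇒surjective p π-inj y)

  p∘σ : ∀ y → p (σ y) ≡ y
  p∘σ y = proj₂ (injective⇒surjective p π-inj y)

  σ∘p : ∀ j → σ (p j) ≡ j
  σ∘p j = π-inj _ _ (p∘σ (p j))

  reindex : (f : Fin n → ℕ) → ∑ f ≡ ∑ (f ∘ p)
  reindex f = sum-permute f (permutation p σ p∘σ σ∘p)

inv-∑ : ∀ {n} (π : Vec (Fin n) n) →
  inv π ≡ ∑ (λ a → ∑ (λ b → 𝟙 (a <? b) * 𝟙 (lookup π b <? lookup π a)))
inv-∑ {n} π = begin
  inv π
    ≡⟨ length-filter _ pairs ⟩
  Σ[ pairs ] (λ ab → 𝟙 (inverted? ab))
    ≡⟨ Σ-concatMap _ (allFin n) _ ⟩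
  Σ[ allFin n ] (λ a → Σ[ map (a ,_) (allFin n) ] (λ ab → 𝟙 (inverted? ab)))
    ≡⟨ Σ-cong (allFin n) (λ a → cong sum (sym (map-∘ (allFin n)))) ⟩
  Σ[ allFin n ] (λ a → Σ[ allFin n ] (λ b → 𝟙 (inverted? (a , b))))
    ≡⟨ Σ-allFin n _ ⟩
  ∑ (λ a → Σ[ allFin n ] (λ b → 𝟙 (inverted? (a , b))))
    ≡⟨ sum-cong-≗ (λ a → trans (Σ-allFin n _) (sum-cong-≗ (λ b → 𝟙-× (a <? b) (lookup π b <? lookup π a)))) ⟩
  ∑ (λ a → ∑ (λ b → 𝟙 (a <? b) * 𝟙 (lookup π b <? lookup π a)))   ∎
  where
  open ≡-Reasoning
  pairs : List (Fin n × Fin n)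
  pairs = concatMap (λ a → map (a ,_) (allFin n)) (allFin n)
  inverted? : (ab : Fin n × Fin n) → Dec _
  inverted? (a , b) = (a <? b) ×-dec (lookup π b <? lookup π a)

module ParkingCount {n} (π : Vec (Fin n) n) (π-inj : IsPerm π) where
  open Inverse π π-inj

  earlier⇒< : ∀ {i k} → Earlier π i k → p k <ᶠ i
  earlier⇒< {i} (i′ , i′<i , pk≡i′) = subst (_<ᶠ i) (sym pk≡i′) i′<i

  <⇒earlier : ∀ {i k} → p k <ᶠ i → Earlier π i k
  <⇒earlier {k = k} pk<i = p k , pk<i , refl

  -- Spot k is blocked for car i: it lies left of car i's spot σ i and is still
  -- empty when car i arrives.  Such a spot must not belong to C_i.
  Blocked : Fin n → Fin n → Set
  Blocked i k = k <ᶠ σ i × ¬ (p k <ᶠ i)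

  blocked? : ∀ i k → Dec (Blocked i k)
  blocked? i k = (k <? σ i) ×-dec ¬? (p k <? i)

  Allowed : Fin n → Fin n → Bool → Set
  Allowed i k b = (k ≡ σ i → b ≡ true) × (Blocked i k → b ≡ false)

  allowed? : ∀ i k b → Dec (Allowed i k b)
  allowed? i k b = ((k ≟ σ i) →-dec (b ≟ᵇ true)) ×-dec (blocked? i k →-dec (b ≟ᵇ false))

  Free : Fin n → Fin n → Set
  Free i k = ¬ (k ≡ σ i) × ¬ Blocked i k

  free? : ∀ i k → Dec (Free i k)
  free? i k = ¬? (k ≟ σ i) ×-dec ¬? (blocked? i k)

  own-not-blocked : ∀ {i k} → k ≡ σ i → ¬ Blocked i k
  own-not-blocked refl (σi<σi , _) = <ᶠ-irrefl refl σi<σi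

  spf⇒allowed : ∀ C → IsSPF π C → ∀ i k → Allowed i k (lookup (lookup C i) k)
  spf⇒allowed C (_ , parks) i k = own , blocked-out
    where
    car-i-parks = parks i (σ i) (p∘σ i)

    own : k ≡ σ i → lookup (lookup C i) k ≡ true
    own refl = []=⇒lookup (proj₁ (proj₁ car-i-parks))

    blocked-out : Blocked i k → lookup (lookup C i) k ≡ false
    blocked-out (k<σi , ¬pk<i) with lookup (lookup C i) k in k∈?C
    ... | false = refl
    ... | true = ⊥-elim (ℕ.<⇒≱ k<σi (proj₂ car-i-parks k (lookup⇒[]= k _ k∈?C) (¬pk<i ∘ earlier⇒<)))

  allowed⇒spf : ∀ C → (∀ i k → Allowed i k (lookup (lookup C i) k)) → IsSPF π C
  allowed⇒spf C ok = (λ i → σ i , own i) , parks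
    where
    own : ∀ i → σ i ∈ lookup C i
    own i = lookup⇒[]= (σ i) _ (proj₁ (ok i (σ i)) refl)

    parks-at-σ : ∀ i → IsMinDiff (lookup C i) (Earlier π i) (σ i)
    parks-at-σ i = (own i , <ᶠ-irrefl (p∘σ i) ∘ earlier⇒<) , leftmost
      where
      leftmost : ∀ k → k ∈ lookup C i → ¬ Earlier π i k → toℕ (σ i) ≤ toℕ k
      leftmost k k∈C ¬earlier = ℕ.≮⇒≥ λ k<σi →
        contradiction (trans (sym ([]=⇒lookup k∈C)) (proj₂ (ok i k) (k<σi , ¬earlier ∘ <⇒earlier)))
                      λ ()

    parks : ∀ i j → p j ≡ i → IsMinDiff (lookup C i) (Earlier π i) j
    parks i j pj≡i = subst (IsMinDiff (lookup C i) (Earlier π i))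
                           (trans (cong σ (sym pj≡i)) (σ∘p j)) (parks-at-σ i)

  spf-indicator : ∀ C →
    𝟙 (isSPF? π C) ≡ ∏ (λ i → ∏ (λ k → 𝟙 (allowed? i k (lookup (lookup C i) k))))
  spf-indicator C =
    trans (𝟙-⇔ (isSPF? π C) (all? λ i → all? (cell? i)) (spf⇒allowed C) (allowed⇒spf C))
          (trans (𝟙-all (λ i → all? (cell? i))) (∏-cong (λ i → 𝟙-all (cell? i))))
    where
    cell? : ∀ i k → Dec (Allowed i k (lookup (lookup C i) k))
    cell? i k = allowed? i k (lookup (lookup C i) k)

  counted : ∀ {i k t f e} → 𝟙 (allowed? i k true) ≡ t → 𝟙 (allowed? i k false) ≡ f →
    𝟙 (free? i k) ≡ e → t + f ≡ 2 ^ e →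
    Σ[ true ∷ false ∷ [] ] (𝟙 ∘ allowed? i k) ≡ 2 ^ 𝟙 (free? i k)
  counted {i} {k} refl refl refl t+f≡2^e =
    trans (cong (𝟙 (allowed? i k true) +_) (+-identityʳ (𝟙 (allowed? i k false)))) t+f≡2^e

  -- A forced cell admits exactly one value, a free cell both.
  allowed-count : ∀ i k → Σ[ true ∷ false ∷ [] ] (𝟙 ∘ allowed? i k) ≡ 2 ^ 𝟙 (free? i k)
  allowed-count i k = by-cases (k ≟ σ i) (blocked? i k)
    where
    by-cases : Dec (k ≡ σ i) → Dec (Blocked i k) →
      Σ[ true ∷ false ∷ [] ] (𝟙 ∘ allowed? i k) ≡ 2 ^ 𝟙 (free? i k)
    by-cases (yes k≡σi) _ =
      counted (𝟙-yes (allowed? i k true) ((λ _ → refl) , ⊥-elim ∘ own-not-blocked k≡σi))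
              (𝟙-no (allowed? i k false) (λ ok → contradiction (proj₁ ok k≡σi) λ ()))
              (𝟙-no (free? i k) (λ fr → proj₁ fr k≡σi)) refl
    by-cases (no k≢σi) (yes bl) =
      counted (𝟙-no (allowed? i k true) (λ ok → contradiction (proj₂ ok bl) λ ()))
              (𝟙-yes (allowed? i k false) (⊥-elim ∘ k≢σi , λ _ → refl))
              (𝟙-no (free? i k) (λ fr → proj₂ fr bl)) refl
    by-cases (no k≢σi) (no ¬bl) =
      counted (𝟙-yes (allowed? i k true) (⊥-elim ∘ k≢σi , ⊥-elim ∘ ¬bl))
              (𝟙-yes (allowed? i k false) (⊥-elim ∘ k≢σi , ⊥-elim ∘ ¬bl))
              (𝟙-yes (free? i k) (k≢σi , ¬bl)) refl

  cell-trichotomy : ∀ i k → 𝟙 (k ≟ σ i) + 𝟙 (blocked? i k) + 𝟙 (free? i k) ≡ 1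
  cell-trichotomy i k = by-cases (k ≟ σ i) (blocked? i k)
    where
    by-cases : Dec (k ≡ σ i) → Dec (Blocked i k) →
      𝟙 (k ≟ σ i) + 𝟙 (blocked? i k) + 𝟙 (free? i k) ≡ 1
    by-cases (yes k≡σi) _ = trans
      (cong₂ (λ b f → b + f) (cong₂ _+_ (𝟙-yes (k ≟ σ i) k≡σi) (𝟙-no (blocked? i k) (own-not-blocked k≡σi)))
                             (𝟙-no (free? i k) (λ fr → proj₁ fr k≡σi))) refl
    by-cases (no k≢σi) (yes bl) = trans
      (cong₂ (λ b f → b + f) (cong₂ _+_ (𝟙-no (k ≟ σ i) k≢σi) (𝟙-yes (blocked? i k) bl))
                             (𝟙-no (free? i k) (λ fr → proj₂ fr bl))) refl
    by-cases (no k≢σi) (no ¬bl) = trans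
      (cong₂ (λ b f → b + f) (cong₂ _+_ (𝟙-no (k ≟ σ i) k≢σi) (𝟙-no (blocked? i k) ¬bl))
                             (𝟙-yes (free? i k) (k≢σi , ¬bl))) refl

  blocked-count : Fin n → ℕ
  blocked-count i = ∑ (λ k → 𝟙 (blocked? i k))

  free-count : Fin n → ℕ
  free-count i = ∑ (λ k → 𝟙 (free? i k))

  row-split : ∀ i → 1 + blocked-count i + free-count i ≡ n
  row-split i = begin
    1 + ∑ bl + ∑ fr                  ≡⟨ cong (λ m → m + ∑ bl + ∑ fr) (sym (∑-δ (σ i))) ⟩
    ∑ own + ∑ bl + ∑ fr              ≡⟨ cong (_+ ∑ fr) (sym (∑-distrib-+ own bl)) ⟩
    ∑ (λ k → own k + bl k) + ∑ fr    ≡⟨ sym (∑-distrib-+ (λ k → own k + bl k) fr) ⟩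
    ∑ (λ k → own k + bl k + fr k)    ≡⟨ sum-cong-≗ (cell-trichotomy i) ⟩
    ∑ {n} (λ _ → 1)                  ≡⟨ ∑-ones n ⟩
    n                                ∎
    where
    open ≡-Reasoning
    own bl fr : Fin n → ℕ
    own k = 𝟙 (k ≟ σ i)
    bl k = 𝟙 (blocked? i k)
    fr k = 𝟙 (free? i k)

  blocked⇔inversion : ∀ q k → 𝟙 (blocked? (p q) k) ≡ 𝟙 (k <? q) * 𝟙 (p q <? p k)
  blocked⇔inversion q k =
    trans (𝟙-⇔ (blocked? (p q) k) ((k <? q) ×-dec (p q <? p k)) to from) (𝟙-× (k <? q) (p q <? p k))
    where
    to : Blocked (p q) k → k <ᶠ q × p q <ᶠ p k
    to (k<σpq , ¬pk<pq) with subst (k <ᶠ_) (σ∘p q) k<σpq | <ᶠ-cmp (p k) (p q)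
    ... | k<q | tri< pk<pq _ _ = contradiction pk<pq ¬pk<pq
    ... | k<q | tri≈ _ pk≡pq _ = contradiction k<q (<ᶠ-irrefl (π-inj k q pk≡pq))
    ... | k<q | tri> _ _ pq<pk = k<q , pq<pk
    from : k <ᶠ q × p q <ᶠ p k → Blocked (p q) k
    from (k<q , pq<pk) = subst (k <ᶠ_) (sym (σ∘p q)) k<q , <ᶠ-asym pq<pk

  blocked-total : ∑ blocked-count ≡ inv π
  blocked-total = begin
    ∑ blocked-count                                     ≡⟨ reindex blocked-count ⟩
    ∑ (λ q → ∑ (λ k → 𝟙 (blocked? (p q) k)))            ≡⟨ sum-cong-≗ (λ q → sum-cong-≗ (blocked⇔inversion q)) ⟩
    ∑ (λ q → ∑ (λ k → 𝟙 (k <? q) * 𝟙 (p q <? p k)))     ≡⟨ ∑-comm (λ q k → 𝟙 (k <? q) * 𝟙 (p q <? p k)) ⟩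
    ∑ (λ k → ∑ (λ q → 𝟙 (k <? q) * 𝟙 (p q <? p k)))     ≡⟨ sym (inv-∑ π) ⟩
    inv π                                               ∎
    where open ≡-Reasoning

  SP-π-formula : SP-π n π ≡ 2 ^ (n * (n ∸ 1) ∸ inv π)
  SP-π-formula = begin
    SP-π n π
      ≡⟨ length-filter (isSPF? π) tuples ⟩
    Σ[ tuples ] (𝟙 ∘ isSPF? π)
      ≡⟨ Σ-cong tuples spf-indicator ⟩
    Σ[ tuples ] (λ C → ∏ (λ i → row-weight i (lookup C i)))
      ≡⟨ Σ-allVecs-∏ (allSubsets n) n row-weight ⟩
    ∏ (λ i → Σ[ allSubsets n ] (row-weight i))
      ≡⟨ ∏-cong (λ i → Σ-allVecs-∏ (true ∷ false ∷ []) n (λ k → 𝟙 ∘ allowed? i k)) ⟩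
    ∏ (λ i → ∏ (λ k → Σ[ true ∷ false ∷ [] ] (𝟙 ∘ allowed? i k)))
      ≡⟨ ∏-cong (λ i → ∏-cong (allowed-count i)) ⟩
    ∏ (λ i → ∏ (λ k → 2 ^ 𝟙 (free? i k)))
      ≡⟨ ∏-cong (λ i → ∏-2^ (λ k → 𝟙 (free? i k))) ⟩
    ∏ (λ i → 2 ^ free-count i)
      ≡⟨ ∏-2^ free-count ⟩
    2 ^ ∑ free-count
      ≡⟨ cong (2 ^_) (∑-complement blocked-count free-count row-split) ⟩
    2 ^ (n * (n ∸ 1) ∸ ∑ blocked-count)
      ≡⟨ cong (λ m → 2 ^ (n * (n ∸ 1) ∸ m)) blocked-total ⟩
    2 ^ (n * (n ∸ 1) ∸ inv π)
      ∎
    where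
    open ≡-Reasoning
    tuples : List (Vec (Subset n) n)
    tuples = allVecs (allSubsets n) n
    row-weight : Fin n → Subset n → ℕ
    row-weight i S = ∏ (λ k → 𝟙 (allowed? i k (lookup S k)))

-- A marking of the values Fin m that are still free.
Marks : ℕ → Set
Marks m = Fin m → Bool

#free : ∀ {m} → Marks m → ℕ
#free F = ∑ (λ y → 𝟙 (T? (F y)))

free-below : ∀ {m} → Marks m → Fin m → ℕ
free-below F x = ∑ (λ y → 𝟙 (y <? x) * 𝟙 (T? (F y)))

layer : ∀ {m} → ℕ → Marks m → Fin m → ℕ
layer D F x = 𝟙 (T? (F x)) * 2 ^ (D ∸ suc (free-below F x))

layer-suc : ∀ {m} D (F : Marks (suc m)) →
  ∑ (layer D F) ≡ 𝟙 (T? (F zero)) * 2 ^ (D ∸ 1) + ∑ (layer (D ∸ 𝟙 (T? (F zero))) (F ∘ suc))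
layer-suc {m} D F = cong₂ _+_ first (sum-cong-≗ shifted)
  where
  first : layer D F zero ≡ 𝟙 (T? (F zero)) * 2 ^ (D ∸ 1)
  first = cong (λ r → 𝟙 (T? (F zero)) * 2 ^ (D ∸ suc r)) (∑-zero {m} (λ y → 𝟙 (suc y <? zero {n = m}) * 𝟙 (T? (F (suc y)))) (λ _ → refl))
  shifted : ∀ x → layer D F (suc x) ≡ layer (D ∸ 𝟙 (T? (F zero))) (F ∘ suc) x
  shifted x = cong (λ e → 𝟙 (T? (F (suc x))) * 2 ^ e) (begin
    D ∸ suc (b₀ + 0 + r)  ≡⟨ cong (λ a → D ∸ suc (a + r)) (+-identityʳ b₀) ⟩
    D ∸ suc (b₀ + r)      ≡⟨ cong (D ∸_) (sym (+-suc b₀ r)) ⟩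
    D ∸ (b₀ + suc r)      ≡⟨ sym (∸-+-assoc D b₀ (suc r)) ⟩
    D ∸ b₀ ∸ suc r        ∎)
    where
    open ≡-Reasoning
    b₀ r : ℕ
    b₀ = 𝟙 (T? (F zero))
    r = free-below (F ∘ suc) x

geometric : ∀ {m} D (F : Marks m) → #free F ≤ D → ∑ (layer D F) + 2 ^ (D ∸ #free F) ≡ 2 ^ D
geometric {zero} D F _ = refl
geometric {suc m} D F K≤D = trans (cong (_+ 2 ^ (D ∸ #free F)) (layer-suc D F)) (by-head (F zero) D K≤D)
  where
  by-head : ∀ b D → 𝟙 (T? b) + #free (F ∘ suc) ≤ D →
    𝟙 (T? b) * 2 ^ (D ∸ 1) + ∑ (layer (D ∸ 𝟙 (T? b)) (F ∘ suc)) + 2 ^ (D ∸ (𝟙 (T? b) + #free (F ∘ suc))) ≡ 2 ^ D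
  by-head false D K≤D = geometric D (F ∘ suc) K≤D
  by-head true (suc E) (s≤s K≤E) = begin
    2 ^ E + 0 + L + 2 ^ (E ∸ #free (F ∘ suc))      ≡⟨ cong (λ a → a + L + 2 ^ (E ∸ #free (F ∘ suc))) (+-identityʳ (2 ^ E)) ⟩
    2 ^ E + L + 2 ^ (E ∸ #free (F ∘ suc))          ≡⟨ +-assoc (2 ^ E) L _ ⟩
    2 ^ E + (L + 2 ^ (E ∸ #free (F ∘ suc)))        ≡⟨ cong (2 ^ E +_) (geometric E (F ∘ suc) K≤E) ⟩
    2 ^ E + 2 ^ E                                  ≡⟨ cong (2 ^ E +_) (sym (+-identityʳ (2 ^ E))) ⟩
    2 ^ suc E                                      ∎
    where
    open ≡-Reasoning
    L = ∑ (layer E (F ∘ suc))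

∑-layer : ∀ {n} (F : Marks n) ℓ → ℓ + #free F ≡ n → ∑ (layer n F) ≡ 2 ^ n ∸ 2 ^ ℓ
∑-layer {n} F ℓ ℓ+K≡n = begin
  ∑ (layer n F)                                 ≡⟨ sym (m+n∸n≡m _ (2 ^ ℓ)) ⟩
  ∑ (layer n F) + 2 ^ ℓ ∸ 2 ^ ℓ                 ≡⟨ cong (λ e → ∑ (layer n F) + 2 ^ e ∸ 2 ^ ℓ) ℓ≡n∸K ⟩
  ∑ (layer n F) + 2 ^ (n ∸ #free F) ∸ 2 ^ ℓ     ≡⟨ cong (_∸ 2 ^ ℓ) (geometric n F K≤n) ⟩
  2 ^ n ∸ 2 ^ ℓ                                 ∎
  where
  open ≡-Reasoning
  ℓ≡n∸K : ℓ ≡ n ∸ #free F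
  ℓ≡n∸K = sym (trans (cong (_∸ #free F) (sym ℓ+K≡n)) (m+n∸n≡m ℓ (#free F)))
  K≤n : #free F ≤ n
  K≤n = subst (#free F ≤_) ℓ+K≡n (ℕ.m≤n+m (#free F) ℓ)

module Placement {n : ℕ} where

  take : Marks n → Fin n → Marks n
  take F x y = if does (y ≟ x) then false else F y

  take-self : ∀ F x → take F x x ≡ false
  take-self F x = cong (if_then false else F x) (dec-true (x ≟ x) refl)

  take-other : ∀ F {x y} → y ≢ x → take F x y ≡ F y
  take-other F {x} {y} y≢x = cong (if_then false else F y) (dec-false (y ≟ x) y≢x)

  take-keeps-taken : ∀ F x {y} → F y ≡ false → take F x y ≡ false
  take-keeps-taken F x {y} Fy≡false = by-cases (y ≟ x)
    where
    by-cases : Dec (y ≡ x) → take F x y ≡ false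
    by-cases (yes refl) = take-self F x
    by-cases (no y≢x) = trans (take-other F y≢x) Fy≡false

  #free-take : ∀ F x → F x ≡ true → suc (#free (take F x)) ≡ #free F
  #free-take F x Fx≡true = begin
    suc (#free (take F x))                                  ≡⟨ +-comm 1 _ ⟩
    #free (take F x) + 1                                    ≡⟨ cong (#free (take F x) +_) (sym (∑-δ x)) ⟩
    #free (take F x) + ∑ (λ y → 𝟙 (y ≟ x))                  ≡⟨ sym (∑-distrib-+ (λ y → 𝟙 (T? (take F x y))) (λ y → 𝟙 (y ≟ x))) ⟩
    ∑ (λ y → 𝟙 (T? (take F x y)) + 𝟙 (y ≟ x))             ≡⟨ sum-cong-≗ (λ y → pointwise y (y ≟ x)) ⟩
    #free F                                                 ∎
    where
    open ≡-Reasoning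
    pointwise : ∀ y → Dec (y ≡ x) → 𝟙 (T? (take F x y)) + 𝟙 (y ≟ x) ≡ 𝟙 (T? (F y))
    pointwise y (yes refl) = trans (cong₂ (λ a b → 𝟙 (T? a) + b) (take-self F x) (𝟙-yes (x ≟ x) refl))
                                   (cong (λ a → 𝟙 (T? a)) (sym Fx≡true))
    pointwise y (no y≢x) = trans (cong₂ (λ a b → 𝟙 (T? a) + b) (take-other F y≢x) (𝟙-no (y ≟ x) y≢x))
                                 (+-identityʳ _)

  stateAt : ∀ {m} → Marks n → Vec (Fin n) m → Fin m → Marks n
  stateAt F v zero = F
  stateAt F (x ∷ᵛ v) (suc q) = stateAt (take F x) v q

  W : ∀ {m} → Marks n → Vec (Fin n) m → ℕ
  W F v = ∏ (λ q → layer n (stateAt F v q) (lookup v q))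

  Σ-W : ∀ m (F : Marks n) ℓ → ℓ + #free F ≡ n →
    Σ[ allVecs (allFin n) m ] (W F) ≡ ∏ (λ (t : Fin m) → 2 ^ n ∸ 2 ^ (ℓ + toℕ t))
  Σ-W zero F ℓ _ = refl
  Σ-W (suc m) F ℓ ℓ+K≡n = begin
    Σ[ allVecs (allFin n) (suc m) ] (W F)
      ≡⟨ Σ-allVecs-suc (allFin n) m (W F) ⟩
    Σ[ allFin n ] (λ x → Σ[ words ] (λ v → layer n F x * W (take F x) v))
      ≡⟨ Σ-cong (allFin n) (λ x → Σ-*ˡ words (layer n F x) (W (take F x))) ⟩
    Σ[ allFin n ] (λ x → layer n F x * Σ[ words ] (W (take F x)))
      ≡⟨ Σ-cong (allFin n) (λ x → continue x (F x) refl) ⟩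
    Σ[ allFin n ] (λ x → layer n F x * rest)
      ≡⟨ Σ-*ʳ (allFin n) rest (layer n F) ⟩
    Σ[ allFin n ] (layer n F) * rest
      ≡⟨ cong (_* rest) (trans (Σ-allFin n (layer n F)) (∑-layer F ℓ ℓ+K≡n)) ⟩
    (2 ^ n ∸ 2 ^ ℓ) * rest
      ≡⟨ cong₂ _*_ (cong (λ e → 2 ^ n ∸ 2 ^ e) (sym (+-identityʳ ℓ)))
                   (∏-cong {m} (λ t → cong (λ e → 2 ^ n ∸ 2 ^ e) (sym (+-suc ℓ (toℕ t))))) ⟩
    ∏ (λ (t : Fin (suc m)) → 2 ^ n ∸ 2 ^ (ℓ + toℕ t))
      ∎
    where
    open ≡-Reasoning
    words : List (Vec (Fin n) m)
    words = allVecs (allFin n) m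
    rest : ℕ
    rest = ∏ (λ (t : Fin m) → 2 ^ n ∸ 2 ^ (suc ℓ + toℕ t))
    -- A taken first letter contributes nothing; a free one leaves ℓ + 1 taken values.
    continue : ∀ x b → F x ≡ b → layer n F x * Σ[ words ] (W (take F x)) ≡ layer n F x * rest
    continue x false Fx≡false = trans (cong (_* Σ[ words ] (W (take F x))) taken) (sym (cong (_* rest) taken))
      where
      taken : layer n F x ≡ 0
      taken = cong (λ b → 𝟙 (T? b) * 2 ^ (n ∸ suc (free-below F x))) Fx≡false
    continue x true Fx≡true = cong (layer n F x *_) (Σ-W m (take F x) (suc ℓ) one-more)
      where
      one-more : suc ℓ + #free (take F x) ≡ n
      one-more = trans (sym (+-suc ℓ _)) (trans (cong (ℓ +_) (#free-take F x Fx≡true)) ℓ+K≡n)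

  taken-stays : ∀ {m} F (v : Vec (Fin n) m) q {y} → F y ≡ false → stateAt F v q y ≡ false
  taken-stays F v zero Fy≡false = Fy≡false
  taken-stays F (x ∷ᵛ v) (suc q) Fy≡false = taken-stays (take F x) v q (take-keeps-taken F x Fy≡false)

  placed-taken : ∀ {m} F (v : Vec (Fin n) m) q k → k <ᶠ q → stateAt F v q (lookup v k) ≡ false
  placed-taken F (x ∷ᵛ v) (suc q) zero _ = taken-stays (take F x) v q (take-self F x)
  placed-taken F (x ∷ᵛ v) (suc q) (suc k) (s≤s k<q) = placed-taken (take F x) v q k k<q

  unplaced-free : ∀ {m} F (v : Vec (Fin n) m) q y → F y ≡ true →
    (∀ k → k <ᶠ q → lookup v k ≢ y) → stateAt F v q y ≡ true
  unplaced-free F v zero y Fy≡true _ = Fy≡true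
  unplaced-free F (x ∷ᵛ v) (suc q) y Fy≡true unplaced =
    unplaced-free (take F x) v q y
      (trans (take-other F (λ y≡x → unplaced zero (s≤s z≤n) (sym y≡x))) Fy≡true)
      (λ k k<q → unplaced (suc k) (s≤s k<q))

  all-free : Marks n
  all-free _ = true

  W-repeat : ∀ {m} (v : Vec (Fin n) m) j k → j <ᶠ k → lookup v j ≡ lookup v k → W all-free v ≡ 0
  W-repeat v j k j<k same = ∏-zero _ k (cong (λ b → 𝟙 (T? b) * 2 ^ (n ∸ suc (free-below S (lookup v k)))) taken)
    where
    S : Marks n
    S = stateAt all-free v k
    taken : S (lookup v k) ≡ false
    taken = subst (λ y → S y ≡ false) same (placed-taken all-free v k j j<k)

  W-non-perm : (v : Vec (Fin n) n) → ¬ IsPerm v → W all-free v ≡ 0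
  W-non-perm v ¬perm with W all-free v ℕ.≟ 0
  ... | yes W≡0 = W≡0
  ... | no W≢0 = contradiction injective ¬perm
    where
    injective : IsPerm v
    injective j k same with <ᶠ-cmp j k
    ... | tri< j<k _ _ = contradiction (W-repeat v j k j<k same) W≢0
    ... | tri≈ _ j≡k _ = j≡k
    ... | tri> _ _ k<j = contradiction (W-repeat v k j k<j (sym same)) W≢0

module PermutationWeight {n} (π : Vec (Fin n) n) (π-inj : IsPerm π) where
  open Inverse π π-inj
  open Placement

  state : Fin n → Marks n
  state q = stateAt all-free π q

  still-free : ∀ q b → 𝟙 (T? (state q (p b))) ≡ 𝟙 (¬? (b <? q))
  still-free q b = 𝟙-⇔ (T? (state q (p b))) (¬? (b <? q)) to from
    where
    to : T (state q (p b)) → ¬ b <ᶠ q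
    to free b<q = subst T (placed-taken all-free π q b b<q) free
    from : ¬ b <ᶠ q → T (state q (p b))
    from b≮q = subst T (sym (unplaced-free all-free π q (p b) refl fresh)) _
      where
      fresh : ∀ k → k <ᶠ q → p k ≢ p b
      fresh k k<q pk≡pb = b≮q (subst (_<ᶠ q) (π-inj k b pk≡pb) k<q)

  later-smaller : Fin n → ℕ
  later-smaller q = ∑ (λ b → 𝟙 (q <? b) * 𝟙 (p b <? p q))

  free-below-at-step : ∀ q → free-below (state q) (p q) ≡ later-smaller q
  free-below-at-step q = begin
    ∑ (λ y → 𝟙 (y <? p q) * 𝟙 (T? (state q y)))           ≡⟨ reindex _ ⟩
    ∑ (λ b → 𝟙 (p b <? p q) * 𝟙 (T? (state q (p b))))     ≡⟨ sum-cong-≗ (λ b → cong (𝟙 (p b <? p q) *_) (still-free q b)) ⟩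
    ∑ (λ b → 𝟙 (p b <? p q) * 𝟙 (¬? (b <? q)))            ≡⟨ sum-cong-≗ later-and-smaller ⟩
    later-smaller q                                       ∎
    where
    open ≡-Reasoning
    later-and-smaller : ∀ b → 𝟙 (p b <? p q) * 𝟙 (¬? (b <? q)) ≡ 𝟙 (q <? b) * 𝟙 (p b <? p q)
    later-and-smaller b =
      trans (sym (𝟙-× (p b <? p q) (¬? (b <? q))))
            (trans (𝟙-⇔ ((p b <? p q) ×-dec ¬? (b <? q)) ((q <? b) ×-dec (p b <? p q)) to from) (𝟙-× (q <? b) (p b <? p q)))
      where
      to : p b <ᶠ p q × ¬ b <ᶠ q → q <ᶠ b × p b <ᶠ p q
      to (pb<pq , b≮q) with <ᶠ-cmp b q
      ... | tri< b<q _ _ = contradiction b<q b≮q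
      ... | tri≈ _ refl _ = contradiction pb<pq (<ᶠ-irrefl refl)
      ... | tri> _ _ q<b = q<b , pb<pq
      from : q <ᶠ b × p b <ᶠ p q → p b <ᶠ p q × ¬ b <ᶠ q
      from (q<b , pb<pq) = pb<pq , <ᶠ-asym q<b

  later-smaller<n : ∀ q → later-smaller q < n
  later-smaller<n q = ∑-<-vanishing _ (λ b → ℕ.*-mono-≤ (𝟙≤1 (q <? b)) (𝟙≤1 (p b <? p q))) q
                        (cong (_* 𝟙 (p q <? p q)) (𝟙-no (q <? q) (<ᶠ-irrefl refl)))

  step-weight : ∀ q → layer n (state q) (p q) ≡ 2 ^ (n ∸ suc (later-smaller q))
  step-weight q = begin
    𝟙 (T? (state q (p q))) * 2 ^ (n ∸ suc (free-below (state q) (p q)))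
      ≡⟨ cong₂ (λ a r → a * 2 ^ (n ∸ suc r)) free-now (free-below-at-step q) ⟩
    1 * 2 ^ (n ∸ suc (later-smaller q))
      ≡⟨ ℕ.*-identityˡ _ ⟩
    2 ^ (n ∸ suc (later-smaller q))
      ∎
    where
    open ≡-Reasoning
    free-now : 𝟙 (T? (state q (p q))) ≡ 1
    free-now = trans (still-free q q) (𝟙-yes (¬? (q <? q)) (<ᶠ-irrefl refl))

  -- The weight of π is 2^(n(n−1) − inv π), because the later-smaller counts add up to inv π.
  W-perm : W all-free π ≡ 2 ^ (n * (n ∸ 1) ∸ inv π)
  W-perm = begin
    W all-free π                                       ≡⟨ ∏-cong step-weight ⟩
    ∏ (λ q → 2 ^ (n ∸ suc (later-smaller q)))         ≡⟨ ∏-2^ (λ q → n ∸ suc (later-smaller q)) ⟩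
    2 ^ ∑ (λ q → n ∸ suc (later-smaller q))           ≡⟨ cong (2 ^_) (∑-complement later-smaller _ (λ q → m+[n∸m]≡n (later-smaller<n q))) ⟩
    2 ^ (n * (n ∸ 1) ∸ ∑ later-smaller)               ≡⟨ cong (λ m → 2 ^ (n * (n ∸ 1) ∸ m)) (sym (inv-∑ π)) ⟩
    2 ^ (n * (n ∸ 1) ∸ inv π)                         ∎
    where open ≡-Reasoning

-- Second half of the theorem: SP(n) = ∏_{i<n} (2^n − 2^i), since SP(n) is the total
-- weight of all words.
SP-formula : ∀ n → SP n ≡ product (map (λ i → 2 ^ n ∸ 2 ^ i) (upTo n))
SP-formula n = begin
  SP n                                                ≡⟨ Σ-filter isPerm? words (SP-π n) ⟩
  Σ[ words ] (λ v → 𝟙 (isPerm? v) * SP-π n v)         ≡⟨ Σ-cong words perm-weight ⟩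
  Σ[ words ] (W all-free)                             ≡⟨ Σ-W n all-free 0 (∑-ones n) ⟩
  ∏ (λ (t : Fin n) → 2 ^ n ∸ 2 ^ toℕ t)               ≡⟨ sym (product-upTo n (λ i → 2 ^ n ∸ 2 ^ i)) ⟩
  product (map (λ i → 2 ^ n ∸ 2 ^ i) (upTo n))        ∎
  where
  open ≡-Reasoning
  open Placement
  words : List (Vec (Fin n) n)
  words = allVecs (allFin n) n
  -- A permutation contributes SP(n, π), which equals its weight; other words weigh 0.
  perm-weight : ∀ v → 𝟙 (isPerm? v) * SP-π n v ≡ W all-free v
  perm-weight v with isPerm? v
  ... | yes perm = trans (cong (_* SP-π n v) (𝟙-yes (isPerm? v) perm))
                         (trans (ℕ.*-identityˡ _)
                                (trans (ParkingCount.SP-π-formula v perm) (sym (PermutationWeight.W-perm v perm))))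
  ... | no ¬perm = trans (cong (_* SP-π n v) (𝟙-no (isPerm? v) ¬perm)) (sym (W-non-perm v ¬perm))

theorem1p1 : (n : ℕ) → 1 ≤ n →
    ((π : Vec (Fin n) n) → IsPerm π → SP-π n π ≡ 2 ^ (n * (n ∸ 1) ∸ inv π))
    × SP n ≡ product (map (λ i → 2 ^ n ∸ 2 ^ i) (upTo n))
theorem1p1 n _ = ParkingCount.SP-π-formula , SP-formula n
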